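{- Let $n\geq 6$ and let $f_2^n:\{0,1\}^n\to\{0,1\}$ be $$f_2^n(x_1,\ldots,x_n)=x_1x_2\oplus x_2x_3\oplus\cdots\oplus x_{n-1}x_n\oplus x_nx_1.$$ Then the Hamming weight of $f_2^n$ is $$wt(f_2^n)=2^{n-1}-2^{\frac{n}{2}-1}\big(1+(-1)^n\big).$$
   Context: Arithmetic is over $\mathbb{F}_2$. The Hamming weight $wt(f)$ of a Boolean function $f$ on $\{0,1\}^n$ is the number of $x\in\{0,1\}^n$ with $f(x)=1$. -}

module Defs where

open import Data.Nat using (ℕ; zero; suc; _+_; _∸_; _^_; _/_; NonZero)
open import Data.Bool using (Bool; true; false; _∧_; _xor_)
open import Data.Fin using (Fin; zero; suc; toℕ; fromℕ<)
open import Data.Nat.DivMod using (_%_; m%n<n)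
open import Data.List using (List; []; _∷_; map; _++_; length; filter; concatMap)
open import Data.Vec using (Vec; []; _∷_; lookup)
open import Data.Integer as ℤ using (ℤ)
open import Data.Bool using (T)
open import Relation.Nullary.Decidable using (Dec)
open import Data.Bool.Properties using (T?)

allInputs : (n : ℕ) → List (Vec Bool n)
allInputs zero = [] ∷ []
allInputs (suc n) = map (false ∷_) (allInputs n) ++ map (true ∷_) (allInputs n)

wt : {n : ℕ} → (Vec Bool n → Bool) → ℕ
wt {n} f = length (filter (λ x → T? (f x)) (allInputs n))

xorSum : ℕ → (ℕ → Bool) → Bool
xorSum zero g = false
xorSum (suc k) g = xorSum k g xor g k

cyc : (n : ℕ) → .{{_ : NonZero n}} → ℕ → Fin n
cyc n i = fromℕ< (m%n<n i n)

-- f₂ⁿ(x) = x₁x₂ ⊕ x₂x₃ ⊕ ⋯ ⊕ x_{n-1}x_n ⊕ x_n x₁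
-- (0-based: ⊕_{i=0}^{n-1} x_i x_{(i+1) mod n}).
f2 : (n : ℕ) → .{{_ : NonZero n}} → Vec Bool n → Bool
f2 n x = xorSum n (λ i → lookup x (cyc n i) ∧ lookup x (cyc n (suc i)))

negOnePow : ℕ → ℤ
negOnePow zero = ℤ.+ 1
negOnePow (suc n) = ℤ.- (negOnePow n)

{-# OPTIONS --safe #-}
module Submission where

-- With walsh f = Σₓ (−1)^f(x) we have 2 wt(f) = 2ⁿ − walsh f.  Cutting the cycle of f₂ⁿ open
-- at x₁ turns walsh f₂ⁿ into the trace of Hⁿ, where H = [[1,1],[1,−1]] is the transfer matrix of one
-- edge x_i x_{i+1}: summing over the free vertex of a path multiplies its matrix by H.
-- Since H² = 2I, the trace of Hⁿ is 2^(n/2) · 2 for even n and 2^((n−1)/2) · tr H = 0 for odd n.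

open import Defs
open import Data.Nat using (ℕ; _≤_; _∸_; _^_; _/_; NonZero)
open import Data.Integer as ℤ using (ℤ; +_; _-_; _*_; _+_)
open import Relation.Binary.PropositionalEquality using (_≡_)

open import Level using (Level)
open import Data.Nat as ℕ using (zero; suc; _<_)
open import Data.Nat.Properties using (≤-refl; <⇒≤; m≤n⇒m<n∨m≡n; m<n⇒m<1+n; +-identityʳ; +-comm)
open import Data.Nat.DivMod using (_%_; m%n<n; n%n≡0; m<n⇒m%n≡m; m*n/n≡m)
open import Data.Bool using (Bool; true; false; not; _∧_; _xor_)
open import Data.Bool.Properties using (T?; xor-assoc; xor-identityʳ)
open import Data.Fin using (fromℕ<)
open import Data.Vec using (Vec; []; _∷_; lookup; head)
open import Data.List using (List; []; _∷_; _++_; map; filter; length)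
open import Data.List.Properties using (length-++; filter-++; length-map)
open import Data.Integer.Properties using (*-assoc; *-zeroʳ; pos-+; pos-*; neg-distrib-+; *-cancelˡ-≡; *-distribˡ-+; *-identityˡ)
open import Data.Integer.Tactic.RingSolver using (solve-∀)
open import Data.Sum using (_⊎_; inj₁; inj₂)
open import Function using (_∘_)
open import Relation.Nullary using (does)
open import Relation.Unary using (Pred; Decidable)
open import Relation.Binary.PropositionalEquality using (refl; sym; trans; cong; cong₂; module ≡-Reasoning)

private
  variable
    ℓ ℓ′ : Level
    A B : Set ℓ
    k m n : ℕ

filter-map : {P : Pred B ℓ′} (P? : Decidable P) (g : A → B) (xs : List A) →
             filter P? (map g xs) ≡ map g (filter (P? ∘ g) xs)
filter-map P? g [] = refl
filter-map P? g (x ∷ xs) with does (P? (g x))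
... | true  = cong (g x ∷_) (filter-map P? g xs)
... | false = filter-map P? g xs

wt-∷ : (f : Vec Bool (suc n) → Bool) → wt f ≡ wt (f ∘ (false ∷_)) ℕ.+ wt (f ∘ (true ∷_))
wt-∷ {n} f = begin
  length (filter P? (map (false ∷_) xs ++ map (true ∷_) xs))
    ≡⟨ cong length (filter-++ P? (map (false ∷_) xs) (map (true ∷_) xs)) ⟩
  length (filter P? (map (false ∷_) xs) ++ filter P? (map (true ∷_) xs))
    ≡⟨ length-++ (filter P? (map (false ∷_) xs)) ⟩
  length (filter P? (map (false ∷_) xs)) ℕ.+ length (filter P? (map (true ∷_) xs))
    ≡⟨ cong₂ ℕ._+_ (length-filter-map (false ∷_)) (length-filter-map (true ∷_)) ⟩
  wt (f ∘ (false ∷_)) ℕ.+ wt (f ∘ (true ∷_)) ∎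
  where
  open ≡-Reasoning
  xs = allInputs n
  P? = λ x → T? (f x)
  length-filter-map : (g : Vec Bool n → Vec Bool (suc n)) →
                      length (filter P? (map g xs)) ≡ wt (f ∘ g)
  length-filter-map g = trans (cong length (filter-map P? g xs)) (length-map g (filter (P? ∘ g) xs))

sign : Bool → ℤ
sign false = + 1
sign true  = ℤ.-1ℤ

walsh : (Vec Bool n → Bool) → ℤ
walsh {zero}  f = sign (f [])
walsh {suc n} f = walsh (f ∘ (false ∷_)) + walsh (f ∘ (true ∷_))

walsh-cong : {f g : Vec Bool n → Bool} → (∀ x → f x ≡ g x) → walsh f ≡ walsh g
walsh-cong {zero}  f≗g = cong sign (f≗g [])
walsh-cong {suc n} f≗g = cong₂ _+_ (walsh-cong (f≗g ∘ (false ∷_))) (walsh-cong (f≗g ∘ (true ∷_)))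

walsh-not : (f : Vec Bool n → Bool) → walsh (not ∘ f) ≡ ℤ.- walsh f
walsh-not {zero} f with f []
... | true  = refl
... | false = refl
walsh-not {suc n} f = trans (cong₂ _+_ (walsh-not (f ∘ (false ∷_))) (walsh-not (f ∘ (true ∷_))))
                            (sym (neg-distrib-+ (walsh (f ∘ (false ∷_))) (walsh (f ∘ (true ∷_)))))

2*wt≡2^n-walsh : (f : Vec Bool n → Bool) → + 2 * + wt f ≡ + (2 ^ n) - walsh f
2*wt≡2^n-walsh {zero} f with f []
... | true  = refl
... | false = refl
2*wt≡2^n-walsh {suc n} f = begin
  + 2 * + wt f                         ≡⟨ cong ((+ 2 *_) ∘ +_) (wt-∷ f) ⟩
  + 2 * + (wt f₀ ℕ.+ wt f₁)            ≡⟨ cong (+ 2 *_) (pos-+ (wt f₀) (wt f₁)) ⟩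
  + 2 * (+ wt f₀ + + wt f₁)            ≡⟨ *-distribˡ-+ (+ 2) (+ wt f₀) (+ wt f₁) ⟩
  + 2 * + wt f₀ + + 2 * + wt f₁        ≡⟨ cong₂ _+_ (2*wt≡2^n-walsh f₀) (2*wt≡2^n-walsh f₁) ⟩
  (+ 2ⁿ - walsh f₀) + (+ 2ⁿ - walsh f₁) ≡⟨ regroup (+ 2ⁿ) (walsh f₀) (walsh f₁) ⟩
  + 2 * + 2ⁿ - walsh f                 ≡⟨ cong (_- walsh f) (sym (pos-* 2 2ⁿ)) ⟩
  + (2 ^ suc n) - walsh f              ∎
  where
  open ≡-Reasoning
  f₀ = f ∘ (false ∷_)
  f₁ = f ∘ (true ∷_)
  2ⁿ = 2 ^ n
  regroup : ∀ q w₀ w₁ → (q - w₀) + (q - w₁) ≡ + 2 * q - (w₀ + w₁)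
  regroup = solve-∀

lookupOr : Vec A n → A → ℕ → A
lookupOr []       d i       = d
lookupOr (x ∷ xs) d zero    = x
lookupOr (x ∷ xs) d (suc i) = lookupOr xs d i

lookup-fromℕ< : (xs : Vec A n) (d : A) (i : ℕ) (i<n : i < n) → lookup xs (fromℕ< i<n) ≡ lookupOr xs d i
lookup-fromℕ< (x ∷ xs) d zero    _           = refl
lookup-fromℕ< (x ∷ xs) d (suc i) (ℕ.s≤s i<n) = lookup-fromℕ< xs d i i<n

lookupOr-length : (xs : Vec A n) (d : A) → lookupOr xs d n ≡ d
lookupOr-length []       d = refl
lookupOr-length (x ∷ xs) d = lookupOr-length xs d

lookup-cyc : (xs : Vec A (suc n)) (i : ℕ) → i ≤ suc n → lookup xs (cyc (suc n) i) ≡ lookupOr xs (head xs) i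
lookup-cyc {n = n} (x ∷ xs) i i≤n =
  trans (lookup-fromℕ< (x ∷ xs) x (i % suc n) (m%n<n i (suc n))) (lookupOr-cyc (m≤n⇒m<n∨m≡n i≤n))
  where
  lookupOr-cyc : i < suc n ⊎ i ≡ suc n → lookupOr (x ∷ xs) x (i % suc n) ≡ lookupOr (x ∷ xs) x i
  lookupOr-cyc (inj₁ i<n)  = cong (lookupOr (x ∷ xs) x) (m<n⇒m%n≡m i<n)
  lookupOr-cyc (inj₂ refl) = trans (cong (lookupOr (x ∷ xs) x) (n%n≡0 (suc n))) (sym (lookupOr-length xs x))

xorSum-cong : (g h : ℕ → Bool) → (∀ i → i < m → g i ≡ h i) → xorSum m g ≡ xorSum m h
xorSum-cong {zero}  g h g≗h = refl
xorSum-cong {suc m} g h g≗h = cong₂ _xor_ (xorSum-cong g h (λ i i<m → g≗h i (m<n⇒m<1+n i<m))) (g≗h m ≤-refl)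

xorSum-suc : (g : ℕ → Bool) → xorSum (suc m) g ≡ g 0 xor xorSum m (g ∘ suc)
xorSum-suc {zero}  g = sym (xor-identityʳ (g 0))
xorSum-suc {suc m} g =
  trans (cong (_xor g (suc m)) (xorSum-suc {m} g)) (xor-assoc (g 0) (xorSum m (g ∘ suc)) (g (suc m)))

chain : Bool → Vec Bool k → Bool → Bool
chain c []       a = c ∧ a
chain c (y ∷ ys) a = (c ∧ y) xor chain y ys a

xorSum-lookupOr : (c : Bool) (ys : Vec Bool k) (a : Bool) →
  xorSum (suc k) (λ i → lookupOr (c ∷ ys) a i ∧ lookupOr (c ∷ ys) a (suc i)) ≡ chain c ys a
xorSum-lookupOr c []       a = refl
xorSum-lookupOr {suc k} c (y ∷ ys) a =
  trans (xorSum-suc {suc k} _) (cong ((c ∧ y) xor_) (xorSum-lookupOr y ys a))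

f2-∷ : (x : Bool) (xs : Vec Bool k) → f2 (suc k) (x ∷ xs) ≡ chain x xs x
f2-∷ {k} x xs = trans (xorSum-cong _ _ edge) (xorSum-lookupOr x xs x)
  where
  edge : ∀ i → i < suc k →
         lookup (x ∷ xs) (cyc (suc k) i) ∧ lookup (x ∷ xs) (cyc (suc k) (suc i)) ≡
         lookupOr (x ∷ xs) x i ∧ lookupOr (x ∷ xs) x (suc i)
  edge i i<n = cong₂ _∧_ (lookup-cyc (x ∷ xs) i (<⇒≤ i<n)) (lookup-cyc (x ∷ xs) (suc i) i<n)

-- Entry (c, a) of H^(k+1), where H = [[1,1],[1,−1]] is indexed by Bool.
transfer : ℕ → Bool → Bool → ℤ
transfer k c a = walsh {k} (λ ys → chain c ys a)

transfer-suc-true : ∀ k (a : Bool) → transfer (suc k) true a ≡ transfer k false a - transfer k true a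
transfer-suc-true k a = cong (λ t → transfer k false a + t) (walsh-not {k} (λ ys → chain true ys a))

transfer-2+ : ∀ k (c a : Bool) → transfer (suc (suc k)) c a ≡ + 2 * transfer k c a
transfer-2+ k false a =
  trans (cong (λ t → transfer (suc k) false a + t) (transfer-suc-true k a))
        (H²₀ (transfer k false a) (transfer k true a))
  where
  H²₀ : ∀ u v → (u + v) + (u - v) ≡ + 2 * u
  H²₀ = solve-∀
transfer-2+ k true a = begin
  transfer (suc (suc k)) true a                  ≡⟨ transfer-suc-true (suc k) a ⟩
  transfer (suc k) false a - transfer (suc k) true a
    ≡⟨ cong (λ t → transfer (suc k) false a - t) (transfer-suc-true k a) ⟩
  (u + v) - (u - v)                              ≡⟨ H²₁ u v ⟩
  + 2 * v                                        ∎
  where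
  open ≡-Reasoning
  u = transfer k false a
  v = transfer k true a
  H²₁ : ∀ u v → (u + v) - (u - v) ≡ + 2 * v
  H²₁ = solve-∀

transfer-iterate : ∀ m k (c a : Bool) → transfer (m ℕ.* 2 ℕ.+ k) c a ≡ + (2 ^ m) * transfer k c a
transfer-iterate zero    k c a = sym (*-identityˡ (transfer k c a))
transfer-iterate (suc m) k c a = begin
  transfer (suc (suc (m ℕ.* 2 ℕ.+ k))) c a ≡⟨ transfer-2+ (m ℕ.* 2 ℕ.+ k) c a ⟩
  + 2 * transfer (m ℕ.* 2 ℕ.+ k) c a       ≡⟨ cong (+ 2 *_) (transfer-iterate m k c a) ⟩
  + 2 * (+ (2 ^ m) * transfer k c a)       ≡⟨ *-assoc (+ 2) (+ (2 ^ m)) (transfer k c a) ⟨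
  + 2 * + (2 ^ m) * transfer k c a         ≡⟨ cong (_* transfer k c a) (pos-* 2 (2 ^ m)) ⟨
  + (2 ^ suc m) * transfer k c a           ∎
  where open ≡-Reasoning

walsh-f2 : walsh (f2 (suc k)) ≡ transfer k false false + transfer k true true
walsh-f2 {k} = cong₂ _+_ (walsh-cong {k} (f2-∷ false)) (walsh-cong {k} (f2-∷ true))

walsh-f2-iterate : ∀ m k → walsh (f2 (suc (m ℕ.* 2 ℕ.+ k))) ≡
                           + (2 ^ m) * (transfer k false false + transfer k true true)
walsh-f2-iterate m k = begin
  walsh (f2 (suc j))
    ≡⟨ walsh-f2 {j} ⟩
  transfer j false false + transfer j true true
    ≡⟨ cong₂ _+_ (transfer-iterate m k false false) (transfer-iterate m k true true) ⟩
  + (2 ^ m) * transfer k false false + + (2 ^ m) * transfer k true true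
    ≡⟨ *-distribˡ-+ (+ (2 ^ m)) (transfer k false false) (transfer k true true) ⟨
  + (2 ^ m) * (transfer k false false + transfer k true true) ∎
  where
  open ≡-Reasoning
  j = m ℕ.* 2 ℕ.+ k

walsh-f2-odd : ∀ m → walsh (f2 (suc (m ℕ.* 2))) ≡ + 0
walsh-f2-odd m = begin
  walsh (f2 (suc (m ℕ.* 2)))            ≡⟨ cong (λ j → walsh (f2 (suc j))) (+-identityʳ (m ℕ.* 2)) ⟨
  walsh (f2 (suc (m ℕ.* 2 ℕ.+ 0)))      ≡⟨ walsh-f2-iterate m 0 ⟩
  + (2 ^ m) * (+ 1 + ℤ.-1ℤ)             ≡⟨ *-zeroʳ (+ (2 ^ m)) ⟩
  + 0                                   ∎
  where open ≡-Reasoning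

walsh-f2-even : ∀ m → walsh (f2 (suc m ℕ.* 2)) ≡ + (2 ^ suc (suc m))
walsh-f2-even m = begin
  walsh (f2 (suc (suc (m ℕ.* 2))))      ≡⟨ cong (λ j → walsh (f2 (suc j))) (+-comm (m ℕ.* 2) 1) ⟨
  walsh (f2 (suc (m ℕ.* 2 ℕ.+ 1)))      ≡⟨ walsh-f2-iterate m 1 ⟩
  + (2 ^ m) * (+ 2 + + 2)               ≡⟨ four (+ (2 ^ m)) ⟩
  + 2 * (+ 2 * + (2 ^ m))               ≡⟨ trans (pos-* 2 (2 ℕ.* 2 ^ m)) (cong (+ 2 *_) (pos-* 2 (2 ^ m))) ⟨
  + (2 ^ suc (suc m))                   ∎
  where
  open ≡-Reasoning
  four : ∀ p → p * (+ 2 + + 2) ≡ + 2 * (+ 2 * p)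
  four = solve-∀

walsh≡2w⇒wt≡2^n-w : (f : Vec Bool (suc n) → Bool) (w : ℕ) → walsh f ≡ + (2 ℕ.* w) → + wt f ≡ + (2 ^ n) - + w
walsh≡2w⇒wt≡2^n-w {n} f w walsh≡2w = *-cancelˡ-≡ (+ 2) (+ wt f) (+ (2 ^ n) - + w) (begin
  + 2 * + wt f                         ≡⟨ 2*wt≡2^n-walsh f ⟩
  + (2 ℕ.* 2 ^ n) - walsh f            ≡⟨ cong (+ (2 ℕ.* 2 ^ n) -_) walsh≡2w ⟩
  + (2 ℕ.* 2 ^ n) - + (2 ℕ.* w)        ≡⟨ cong₂ _-_ (pos-* 2 (2 ^ n)) (pos-* 2 w) ⟩
  + 2 * + (2 ^ n) - + 2 * + w          ≡⟨ factor-2 (+ (2 ^ n)) (+ w) ⟩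
  + 2 * (+ (2 ^ n) - + w)              ∎)
  where
  open ≡-Reasoning
  factor-2 : ∀ p q → + 2 * p - + 2 * q ≡ + 2 * (p - q)
  factor-2 = solve-∀

data EvenOrOdd : ℕ → Set where
  even : ∀ m → EvenOrOdd (m ℕ.* 2)
  odd  : ∀ m → EvenOrOdd (suc (m ℕ.* 2))

evenOrOdd : ∀ n → EvenOrOdd n
evenOrOdd zero = even 0
evenOrOdd (suc n) with evenOrOdd n
... | even m = odd m
... | odd m  = even (suc m)

negOnePow-even : ∀ m → negOnePow (m ℕ.* 2) ≡ + 1
negOnePow-even zero    = refl
negOnePow-even (suc m) = cong (ℤ.-_ ∘ ℤ.-_) (negOnePow-even m)

wt-f2 : (n : ℕ) → .{{_ : NonZero n}} →
        + wt (f2 n) ≡ + (2 ^ (n ∸ 1)) - + (2 ^ (n / 2 ∸ 1)) * (+ 1 + negOnePow n)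
wt-f2 n with evenOrOdd n
wt-f2 _ {{()}} | even zero
wt-f2 _ | even (suc m) rewrite m*n/n≡m (suc m) 2 ⦃ _ ⦄ | negOnePow-even m =
  trans (walsh≡2w⇒wt≡2^n-w (f2 _) (2 ^ suc m) (walsh-f2-even m))
        (cong (+ (2 ^ suc (m ℕ.* 2)) -_) (trans (pos-* 2 (2 ^ m)) (two≡1+1 (+ (2 ^ m)))))
  where
  two≡1+1 : ∀ p → + 2 * p ≡ p * (+ 1 + + 1)
  two≡1+1 = solve-∀
wt-f2 _ | odd m rewrite negOnePow-even m =
  trans (walsh≡2w⇒wt≡2^n-w (f2 _) 0 (walsh-f2-odd m))
        (no-correction (+ (2 ^ (m ℕ.* 2))) (+ (2 ^ (suc (m ℕ.* 2) / 2 ∸ 1))))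
  where
  no-correction : ∀ x r → x - + 0 ≡ x - r * (+ 1 + ℤ.-1ℤ)
  no-correction = solve-∀

-- The identity holds for every n ≥ 1.
mainTheorem3 : (n : ℕ) → .{{_ : NonZero n}} → 6 ≤ n →
    + wt (f2 n) ≡ + (2 ^ (n ∸ 1)) - + (2 ^ (n / 2 ∸ 1)) * (+ 1 + negOnePow n)
mainTheorem3 n _ = wt-f2 n
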